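{- Let $M=(ST,AC,\{av_C\}_{C\subseteq AG},\{out_C\}_{C\subseteq AG},L)$ be an action model and $s\in ST$. The following three sets of conditions are equivalent: (1) (a) for all $a\in AG$, $\bigcup\{out_{\{a\}}(s,\sigma_a)\mid\sigma_a\in JA_{\{a\}}\}=out_\emptyset(s,\emptyset)$; and (b) for all nonempty $C\subseteq AG$ and $\sigma_C\in JA_C$, $out_C(s,\sigma_C)=\bigcap\{out_{\{a\}}(s,\sigma_C|_{\{a\}})\mid a\in C\}$. (2) (a) for all $a\in AG$, $\bigcup\{out_{\{a\}}(s,\sigma_a)\mid\sigma_a\in JA_{\{a\}}\}=out_\emptyset(s,\emptyset)$; and (b) for all $C,D\subseteq AG$ with $C\cap D=\emptyset$, $\sigma_C\in JA_C$, $\sigma_D\in JA_D$: $out_{C\cup D}(s,\sigma_C\cup\sigma_D)=out_C(s,\sigma_C)\cap out_D(s,\sigma_D)$. (3) (a) for all $C\subseteq AG$ and $\sigma_C\in JA_C$, $out_C(s,\sigma_C)=\bigcup\{out_{AG}(s,\sigma_{AG})\mid\sigma_{AG}\in JA_{AG},\ \sigma_C\subseteq\sigma_{AG}\}$; and (b) for all $C\subseteq AG$ and $\sigma_C,\sigma'_C,\sigma''_C\in JA_C$, if $\sigma''_C$ is a fusion of $\sigma_C$ and $\sigma'_C$, then $out_C(s,\sigma_C)\cap out_C(s,\sigma'_C)\subseteq out_C(s,\sigma''_C)$.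
   Context: $AG$ is a finite nonempty set of agents; $AP$ a countable set of atomic propositions. For a nonempty set $AC$ of actions and $C\subseteq AG$, $JA_C$ is the set of all functions $\sigma_C:C\to AC$ ($JA_\emptyset=\{\emptyset\}$). For $D\subseteq C$, $\sigma_C|_D$ is the restriction; $\sigma_D\subseteq\sigma_C$ means $\sigma_D=\sigma_C|_D$; $\sigma_a$ denotes an element of $JA_{\{a\}}$. For disjoint $C,D$, $\sigma_C\cup\sigma_D\in JA_{C\cup D}$ is the union of functions. An action model is a tuple $(ST,AC,\{av_C\}_{C\subseteq AG},\{out_C\}_{C\subseteq AG},L)$ with $ST$ a nonempty set, $AC$ a nonempty set, $av_C:ST\to\mathcal P(JA_C)$, $out_C:ST\times JA_C\to\mathcal P(ST)$, $L:ST\to\mathcal P(AP)$. For $\sigma_C,\sigma'_C,\sigma''_C\in JA_C$, $\sigma''_C$ is a fusion of $\sigma_C$ and $\sigma'_C$ if for every $a\in C$, $\sigma''_C|_{\{a\}}$ equals $\sigma_C|_{\{a\}}$ or $\sigma'_C|_{\{a\}}$. -}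

module Defs where

open import Data.Nat using (ℕ)
open import Level using () renaming (zero to lzero)
open import Data.Bool using (Bool; true; false)
open import Data.Unit using (⊤; tt)
open import Data.Product using (_×_; _,_; Σ; Σ-syntax)
open import Data.Sum using (inj₁; inj₂)
open import Data.Vec using ([]; _∷_)
open import Data.Fin using (Fin; zero; suc)
open import Data.Fin.Subset using (Subset; _∈_; _⊆_; ⁅_⁆; _∪_; _∩_; Nonempty; Empty)
  renaming (⊥ to ∅; ⊤ to Full)
open import Data.Fin.Subset.Properties using (⊆⊤; x∈⁅y⁆⇒x≡y; x∈p∪q⁻; ∉⊥)
open import Data.Vec using (_[_]=_)
open import Relation.Nullary using (contradiction)
open import Relation.Binary.PropositionalEquality using (_≡_; subst)
import Relation.Unary
open Relation.Unary using (Pred; _≐_; ⋃; ⋂)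
  renaming (_∩_ to _∩ₚ_)
open import Data.Sum using (_⊎_)
open _[_]=_

-- Agents: AG = Fin n.
-- Joint actions of coalition C: one action for each member of C,
-- represented canonically (so that ≡ is equality of functions C → AC).
JA : ∀ {n} → Set → Subset n → Set
JA AC [] = ⊤
JA AC (true ∷ C) = AC × JA AC C
JA AC (false ∷ C) = JA AC C

get : ∀ {n} {AC : Set} {C : Subset n} {a : Fin n} → JA AC C → a ∈ C → AC
get {C = true ∷ C} (x , σ) here = x
get {C = true ∷ C} (x , σ) (there p) = get σ p
get {C = false ∷ C} σ (there p) = get σ p

build : ∀ {n} {AC : Set} (C : Subset n) → ((a : Fin n) → a ∈ C → AC) → JA AC C
build [] f = tt
build (true ∷ C) f = f zero here , build C (λ a p → f (suc a) (there p))
build (false ∷ C) f = build C (λ a p → f (suc a) (there p))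

restrict : ∀ {n} {AC : Set} {C D : Subset n} → D ⊆ C → JA AC C → JA AC D
restrict {D = D} D⊆C σ = build D (λ a p → get σ (D⊆C p))

emptyJA : ∀ {n} {AC : Set} → JA AC (∅ {n})
emptyJA {n} = build (∅ {n}) (λ a p → contradiction p ∉⊥)

_∪J_ : ∀ {n} {AC : Set} {C D : Subset n} → JA AC C → JA AC D → JA AC (C ∪ D)
_∪J_ {AC = AC} {C = C} {D} σC σD = build (C ∪ D) λ a p → h (x∈p∪q⁻ C D p)
  where
  h : ∀ {a} → a ∈ C ⊎ a ∈ D → AC
  h (inj₁ q) = get σC q
  h (inj₂ q) = get σD q

single⊆ : ∀ {n} {C : Subset n} {a : Fin n} → a ∈ C → ⁅ a ⁆ ⊆ C
single⊆ {C = C} a∈C p = subst (_∈ C) (Relation.Binary.PropositionalEquality.sym (x∈⁅y⁆⇒x≡y _ p)) a∈C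

Disjoint : ∀ {n} → Subset n → Subset n → Set
Disjoint C D = Empty (C ∩ D)

-- σ_D ⊆ σ_C  :  σ_D = σ_C|_D
extends : ∀ {n} {AC : Set} {C D : Subset n} (D⊆C : D ⊆ C) → JA AC D → JA AC C → Set
extends D⊆C σD σC = σD ≡ restrict D⊆C σC

IsFusion : ∀ {n} {AC : Set} {C : Subset n} → JA AC C → JA AC C → JA AC C → Set
IsFusion {n} {AC} {C = C} σ'' σ σ' =
  (a : Fin n) (p : a ∈ C) →
  (R p σ'' ≡ R p σ) ⊎ (R p σ'' ≡ R p σ')
  where
  R : ∀ {a} → a ∈ C → JA AC C → JA AC ⁅ a ⁆
  R p = restrict {AC = AC} {C = C} (single⊆ p)

AP : Set
AP = ℕ

record ActionModel (n : ℕ) : Set₁ where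
  field
    ST  : Set
    st₀ : ST                                   -- ST nonempty
    AC  : Set
    ac₀ : AC                                   -- AC nonempty
    av  : (C : Subset n) → ST → Pred (JA AC C) lzero
    out : (C : Subset n) → ST → JA AC C → Pred ST lzero
    L   : ST → Pred AP lzero

module _ {n : ℕ} (M : ActionModel n) (s : ActionModel.ST M) where
  open ActionModel M

  Cond-a : Set
  Cond-a = (a : Fin n) → ⋃ (JA AC ⁅ a ⁆) (λ σa → out ⁅ a ⁆ s σa) ≐ out ∅ s (emptyJA {n} {AC})

  Cond1 : Set
  Cond1 = Cond-a ×
    ((C : Subset n) → Nonempty C → (σC : JA AC C) →
      out C s σC ≐ ⋂ (Σ[ a ∈ Fin n ] a ∈ C) (λ { (a , p) → out ⁅ a ⁆ s (restrict {AC = AC} {C = C} (single⊆ p) σC) }))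

  Cond2 : Set
  Cond2 = Cond-a ×
    ((C D : Subset n) → Disjoint C D → (σC : JA AC C) (σD : JA AC D) →
      out (C ∪ D) s (_∪J_ {AC = AC} {C = C} {D = D} σC σD) ≐ (out C s σC ∩ₚ out D s σD))

  Cond3 : Set
  Cond3 =
    ((C : Subset n) (σC : JA AC C) →
      out C s σC ≐ ⋃ (Σ[ σAG ∈ JA AC (Full {n}) ] extends {AC = AC} {C = Full {n}} {D = C} ⊆⊤ σC σAG) (λ { (σAG , _) → out (Full {n}) s σAG }))
    ×
    ((C : Subset n) (σ σ' σ'' : JA AC C) → IsFusion {AC = AC} {C = C} σ'' σ σ' →
      (out C s σ ∩ₚ out C s σ') Relation.Unary.⊆ out C s σ'')

{-# OPTIONS --safe #-}
-- Under condition (a), each of (1), (2) and (3) is equivalent to the decomposition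
--   out_C(s, σ_C) = out_∅(s, ∅) ∩ ⋂ { out_{a}(s, σ_C|_{a}) | a ∈ C }   for every C ⊆ AG, including ∅
-- (Decomposes below). For (1) this only adds the empty coalition and the factor out_∅, which (a)
-- makes redundant when C ≠ ∅. (2) yields it by splitting off one agent at a time,
-- C = {a} ⊎ (C ∖ {a}); conversely the decomposition turns the outcomes of a disjoint union into an
-- intersection. It gives (3a) by completing σ_C outside C with, for each agent a, an action whose
-- outcome contains the given state (one exists by (a)), and (3b) because a fusion agrees, agent by
-- agent, with one of the two joint actions it fuses. Finally (3) implies (2): both out_{a} and
-- out_∅ are the union of all out_AG, and a state in out_C(σ_C) ∩ out_D(σ_D) lies in out_AG(σ) and
-- out_AG(σ′) for extensions σ of σ_C and σ′ of σ_D, hence by (3b) also in out_AG of the fusion that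
-- plays σ_C ∪ σ_D on C ∪ D and σ elsewhere, which extends σ_C ∪ σ_D.
module Submission where

open import Defs
open import Data.Nat using (ℕ; NonZero)
open import Level using () renaming (zero to lzero)
open import Data.Product using (_×_; _,_; proj₁; proj₂; Σ-syntax)
open import Data.Sum using (_⊎_; inj₁; inj₂)
open import Data.Bool using (true; false)
open import Data.Vec using (_∷_; []; _[_]=_)
open _[_]=_
open import Data.Vec.Properties.WithK using ([]=-irrelevant)
open import Data.Fin using (Fin)
open import Data.Fin.Subset using (Subset; _∈_; _∉_; _⊆_; ⁅_⁆; _∪_; _∩_; ∁; Empty)
  renaming (⊥ to ∅; ⊤ to Full)
open import Data.Fin.Subset.Properties
  using (_∈?_; nonempty?; Empty-unique; ∉⊥; ∈⊤; ⊆⊤; x∈⁅x⁆; x∈⁅y⁆⇒x≡y; p⊆p∪q; q⊆p∪q;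
         x∈p∪q⁺; x∈p∪q⁻; x∈p∩q⁺; x∈p∩q⁻; x∈∁p⇒x∉p; x∉p⇒x∈∁p; ⊆-antisym)
open import Data.List using (List; []; _∷_; allFin)
open import Data.List.Membership.Propositional using () renaming (_∈_ to _∈ₗ_)
open import Data.List.Membership.Propositional.Properties using (∈-allFin)
open import Data.List.Relation.Unary.Any using (here; there)
open import Data.List.Relation.Unary.Any.Properties using (¬Any[])
open import Function.Base using (_∘_; _∋_)
open import Function.Bundles using (_⇔_; mk⇔)
open import Relation.Nullary using (Dec; yes; no; contradiction)
open import Relation.Binary.PropositionalEquality using (_≡_; refl; sym; trans; cong₂; subst)
open import Relation.Unary using (Pred; _≐_; ⋃) renaming (_⊆_ to _⊆ₚ_; _∩_ to _∩ₚ_)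

get-build : ∀ {n} {AC : Set} (C : Subset n) (f : ∀ a → a ∈ C → AC) {a} (p : a ∈ C) →
  get (build C f) p ≡ f a p
get-build (true ∷ C)  f here      = refl
get-build (true ∷ C)  f (there p) = get-build C _ p
get-build (false ∷ C) f (there p) = get-build C _ p

JA-ext : ∀ {n} {AC : Set} (C : Subset n) {σ τ : JA AC C} →
  (∀ {a} (p : a ∈ C) → get σ p ≡ get τ p) → σ ≡ τ
JA-ext []          _ = refl
JA-ext (true ∷ C)  h = cong₂ _,_ (h here) (JA-ext C (λ p → h (there p)))
JA-ext (false ∷ C) h = JA-ext C (λ p → h (there p))

⁅a⁆∪[C∩∁⁅a⁆]≡C : ∀ {n} {C : Subset n} {a : Fin n} → a ∈ C → ⁅ a ⁆ ∪ (C ∩ ∁ ⁅ a ⁆) ≡ C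
⁅a⁆∪[C∩∁⁅a⁆]≡C {C = C} {a} a∈C = ⊆-antisym split-⊆ ⊆-split
  where
  split-⊆ : ⁅ a ⁆ ∪ (C ∩ ∁ ⁅ a ⁆) ⊆ C
  split-⊆ p with x∈p∪q⁻ ⁅ a ⁆ (C ∩ ∁ ⁅ a ⁆) p
  ... | inj₁ p∈⁅a⁆ = single⊆ a∈C p∈⁅a⁆
  ... | inj₂ p∈C∖a = proj₁ (x∈p∩q⁻ C (∁ ⁅ a ⁆) p∈C∖a)
  ⊆-split : C ⊆ ⁅ a ⁆ ∪ (C ∩ ∁ ⁅ a ⁆)
  ⊆-split {b} p with b ∈? ⁅ a ⁆
  ... | yes b∈⁅a⁆ = x∈p∪q⁺ (inj₁ b∈⁅a⁆)
  ... | no  b∉⁅a⁆ = x∈p∪q⁺ (inj₂ (x∈p∩q⁺ (p , x∉p⇒x∈∁p b∉⁅a⁆)))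

⁅a⁆-disjoint-C∩∁⁅a⁆ : ∀ {n} (C : Subset n) (a : Fin n) → Disjoint ⁅ a ⁆ (C ∩ ∁ ⁅ a ⁆)
⁅a⁆-disjoint-C∩∁⁅a⁆ C a (b , p) with x∈p∩q⁻ ⁅ a ⁆ (C ∩ ∁ ⁅ a ⁆) p
... | b∈⁅a⁆ , b∈C∖a = x∈∁p⇒x∉p (proj₂ (x∈p∩q⁻ C (∁ ⁅ a ⁆) b∈C∖a)) b∈⁅a⁆

module JointActions {n : ℕ} {AC : Set} where

  private variable
    B C D : Subset n
    a b : Fin n

  AG : Subset n
  AG = Full

  get-cong : (σ : JA AC C) (p : a ∈ C) (q : b ∈ C) → a ≡ b → get σ p ≡ get σ q
  get-cong σ p q refl rewrite []=-irrelevant p q = refl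

  subst-JA : (P : (C : Subset n) → JA AC C → Set) → C ≡ D → {σ : JA AC C} {τ : JA AC D} →
    (∀ {a} (p : a ∈ C) (q : a ∈ D) → get σ p ≡ get τ q) → P C σ → P D τ
  subst-JA P refl agree = subst (P _) (JA-ext _ (λ p → agree p p))

  get-restrict : (D⊆C : D ⊆ C) (σ : JA AC C) (p : a ∈ D) → get (restrict D⊆C σ) p ≡ get σ (D⊆C p)
  get-restrict {D = D} D⊆C σ = get-build D _

  extends⁺ : (D⊆C : D ⊆ C) {σD : JA AC D} {σC : JA AC C} →
    (∀ {a} (p : a ∈ D) → get σD p ≡ get σC (D⊆C p)) → extends D⊆C σD σC
  extends⁺ {D = D} D⊆C {σC = σC} agree = JA-ext D (λ p → trans (agree p) (sym (get-restrict D⊆C σC p)))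

  extends⁻ : (D⊆C : D ⊆ C) {σD : JA AC D} (σC : JA AC C) →
    extends D⊆C σD σC → (p : a ∈ D) (q : a ∈ C) → get σD p ≡ get σC q
  extends⁻ D⊆C σC refl p q = trans (get-restrict D⊆C σC p) (get-cong σC _ q refl)

  -- The type ascriptions let Agda infer the clause function of _∪J_, which is local to Defs.
  get-∪Jˡ : Disjoint C D → (σC : JA AC C) (σD : JA AC D) (p : a ∈ C) (q : a ∈ C ∪ D) →
    get (_∪J_ {C = C} {D = D} σC σD) q ≡ get σC p
  get-∪Jˡ {C = C} {D = D} disj σC σD p q
    with get (_∪J_ {C = C} {D = D} σC σD) q ≡ _ ∋ get-build (C ∪ D) _ q
  ... | eq with x∈p∪q⁻ C D q
  ... | inj₁ p′ = trans eq (get-cong σC p′ p refl)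
  ... | inj₂ p′ = contradiction (_ , x∈p∩q⁺ (p , p′)) disj

  get-∪Jʳ : Disjoint C D → (σC : JA AC C) (σD : JA AC D) (p : a ∈ D) (q : a ∈ C ∪ D) →
    get (_∪J_ {C = C} {D = D} σC σD) q ≡ get σD p
  get-∪Jʳ {C = C} {D = D} disj σC σD p q
    with get (_∪J_ {C = C} {D = D} σC σD) q ≡ _ ∋ get-build (C ∪ D) _ q
  ... | eq with x∈p∪q⁻ C D q
  ... | inj₁ p′ = contradiction (_ , x∈p∩q⁺ (p′ , p)) disj
  ... | inj₂ p′ = trans eq (get-cong σD p′ p refl)

  extends-∪Jˡ : Disjoint C D → (σC : JA AC C) (σD : JA AC D) (σ : JA AC AG) →
    extends {C = AG} {D = C ∪ D} ⊆⊤ (_∪J_ {C = C} {D = D} σC σD) σ → extends {C = AG} {D = C} ⊆⊤ σC σ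
  extends-∪Jˡ {D = D} disj σC σD σ e = extends⁺ ⊆⊤ (λ p →
    trans (sym (get-∪Jˡ disj σC σD p (p⊆p∪q D p))) (extends⁻ ⊆⊤ σ e (p⊆p∪q D p) ∈⊤))

  extends-∪Jʳ : Disjoint C D → (σC : JA AC C) (σD : JA AC D) (σ : JA AC AG) →
    extends {C = AG} {D = C ∪ D} ⊆⊤ (_∪J_ {C = C} {D = D} σC σD) σ → extends {C = AG} {D = D} ⊆⊤ σD σ
  extends-∪Jʳ {C = C} disj σC σD σ e = extends⁺ ⊆⊤ (λ p →
    trans (sym (get-∪Jʳ disj σC σD p (q⊆p∪q C _ p))) (extends⁻ ⊆⊤ σ e (q⊆p∪q C _ p) ∈⊤))

  get-∪J-restrict : Disjoint C D → (C⊆B : C ⊆ B) (D⊆B : D ⊆ B) (σ : JA AC B)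
    (q : a ∈ C ∪ D) (q′ : a ∈ B) →
    get (_∪J_ {C = C} {D = D} (restrict C⊆B σ) (restrict D⊆B σ)) q ≡ get σ q′
  get-∪J-restrict {C = C} {D = D} disj C⊆B D⊆B σ q q′ with x∈p∪q⁻ C D q
  ... | inj₁ p = trans (get-∪Jˡ disj _ _ p q) (extends⁻ C⊆B σ refl p q′)
  ... | inj₂ p = trans (get-∪Jʳ disj _ _ p q) (extends⁻ D⊆B σ refl p q′)

  _↾_ : JA AC C → a ∈ C → JA AC ⁅ a ⁆
  σ ↾ p = restrict (single⊆ p) σ

  get-↾ : (σ : JA AC C) (p : a ∈ C) (r : b ∈ ⁅ a ⁆) → get (σ ↾ p) r ≡ get σ p
  get-↾ σ p r = trans (get-restrict (single⊆ p) σ r) (get-cong σ _ p (x∈⁅y⁆⇒x≡y _ r))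

  ↾-cong : (σ : JA AC C) (p : a ∈ C) (τ : JA AC D) (q : a ∈ D) → get σ p ≡ get τ q → σ ↾ p ≡ τ ↾ q
  ↾-cong σ p τ q eq = JA-ext ⁅ _ ⁆ (λ r → trans (get-↾ σ p r) (trans eq (sym (get-↾ τ q r))))

  ↾-⁅⁆ : (σ : JA AC ⁅ a ⁆) (r : a ∈ ⁅ a ⁆) → σ ↾ r ≡ σ
  ↾-⁅⁆ σ r = JA-ext ⁅ _ ⁆ (λ r′ → trans (get-↾ σ r r′) (get-cong σ r r′ (sym (x∈⁅y⁆⇒x≡y _ r′))))

  private
    pick : JA AC C → JA AC AG → Dec (a ∈ C) → AC
    pick σ τ (yes p) = get σ p
    pick {a = a} σ τ (no _) = get τ (∈⊤ {x = a})

  override : (C : Subset n) → JA AC C → JA AC AG → JA AC AG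
  override C σ τ = build AG (λ a _ → pick σ τ (a ∈? C))

  get-override-∈ : (σ : JA AC C) (τ : JA AC AG) (p : a ∈ C) (q : a ∈ AG) →
    get (override C σ τ) q ≡ get σ p
  get-override-∈ {C = C} {a = a} σ τ p q = trans (get-build AG _ q) (pick-∈ (a ∈? C))
    where
    pick-∈ : (d : Dec (a ∈ C)) → pick σ τ d ≡ get σ p
    pick-∈ (yes p′)  = get-cong σ p′ p refl
    pick-∈ (no a∉C) = contradiction p a∉C

  get-override-∉ : (σ : JA AC C) (τ : JA AC AG) → a ∉ C → (q : a ∈ AG) →
    get (override C σ τ) q ≡ get τ q
  get-override-∉ {C = C} {a = a} σ τ a∉C q = trans (get-build AG _ q) (pick-∉ (a ∈? C))
    where
    pick-∉ : (d : Dec (a ∈ C)) → pick σ τ d ≡ get τ q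
    pick-∉ (yes a∈C) = contradiction a∈C a∉C
    pick-∉ (no _)    = get-cong τ ∈⊤ q refl

  override-extends : (σ : JA AC C) (τ : JA AC AG) → extends (⊆⊤ {p = C}) σ (override C σ τ)
  override-extends {C = C} σ τ = extends⁺ (⊆⊤ {p = C}) (λ p → sym (get-override-∈ σ τ p (⊆⊤ p)))

  override-∪J-fusion : (disj : Disjoint C D) {σC : JA AC C} {σD : JA AC D} (σ σ′ : JA AC AG) →
    extends {C = AG} {D = C} ⊆⊤ σC σ → extends {C = AG} {D = D} ⊆⊤ σD σ′ →
    IsFusion {C = AG} (override (C ∪ D) (_∪J_ {C = C} {D = D} σC σD) σ) σ σ′
  override-∪J-fusion {C = C} {D = D} disj {σC} {σD} σ σ′ e e′ a q = fusion-at (a ∈? (C ∪ D))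
    where
    τ = _∪J_ {C = C} {D = D} σC σD
    σ″ = override (C ∪ D) τ σ
    fusion-at : Dec (a ∈ C ∪ D) → (σ″ ↾ q ≡ σ ↾ q) ⊎ (σ″ ↾ q ≡ σ′ ↾ q)
    fusion-at (no a∉C∪D) = inj₁ (↾-cong σ″ q σ q (get-override-∉ τ σ a∉C∪D q))
    fusion-at (yes a∈C∪D) with x∈p∪q⁻ C D a∈C∪D
    ... | inj₁ p = inj₁ (↾-cong σ″ q σ q
                    (trans (get-override-∈ τ σ a∈C∪D q)
                      (trans (get-∪Jˡ disj σC σD p a∈C∪D) (extends⁻ ⊆⊤ σ e p q))))
    ... | inj₂ p = inj₂ (↾-cong σ″ q σ′ q
                    (trans (get-override-∈ τ σ a∈C∪D q)
                      (trans (get-∪Jʳ disj σC σD p a∈C∪D) (extends⁻ ⊆⊤ σ′ e′ p q))))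

module _ {n : ℕ} (M : ActionModel n) (s : ActionModel.ST M) where
  open ActionModel M
  open JointActions {n} {AC}

  private variable
    C D : Subset n
    a : Fin n
    x : ST

  ∅J : JA AC (∅ {n})
  ∅J = emptyJA {n} {AC}

  Individually : (C : Subset n) → JA AC C → Pred ST lzero
  Individually C σ x = ∀ {a} (p : a ∈ C) → out ⁅ a ⁆ s (σ ↾ p) x

  DecomposesAt : (C : Subset n) → JA AC C → Set
  DecomposesAt C σ = out C s σ ≐ (out ∅ s ∅J ∩ₚ Individually C σ)

  ExtensionOutcomes : (C : Subset n) → JA AC C → Pred ST lzero
  ExtensionOutcomes C σC = ⋃ (Σ[ σAG ∈ JA AC AG ] extends {C = AG} {D = C} ⊆⊤ σC σAG) (out AG s ∘ proj₁)

  Decomposes : Set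
  Decomposes = (C : Subset n) (σ : JA AC C) → DecomposesAt C σ

  out-↾-cong : (σ : JA AC C) (p : a ∈ C) (τ : JA AC D) (q : a ∈ D) → get σ p ≡ get τ q →
    out ⁅ a ⁆ s (σ ↾ p) ⊆ₚ out ⁅ a ⁆ s (τ ↾ q)
  out-↾-cong σ p τ q eq = subst (λ σa → out _ s σa _) (↾-cong σ p τ q eq)

  Individually-antitone : (D⊆C : D ⊆ C) (σC : JA AC C) (σD : JA AC D) →
    (∀ {a} (p : a ∈ D) → get σD p ≡ get σC (D⊆C p)) → Individually C σC ⊆ₚ Individually D σD
  Individually-antitone D⊆C σC σD agree ind p = out-↾-cong σC (D⊆C p) σD p (sym (agree p)) (ind (D⊆C p))

  Individually-⁅⁆ : (σa : JA AC ⁅ a ⁆) → Individually ⁅ a ⁆ σa ≐ out ⁅ a ⁆ s σa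
  Individually-⁅⁆ {a} σa = to , from
    where
    to : Individually ⁅ a ⁆ σa ⊆ₚ out ⁅ a ⁆ s σa
    to ind = subst (λ τ → out ⁅ a ⁆ s τ _) (↾-⁅⁆ σa (x∈⁅x⁆ a)) (ind (x∈⁅x⁆ a))
    from : out ⁅ a ⁆ s σa ⊆ₚ Individually ⁅ a ⁆ σa
    from o r with x∈⁅y⁆⇒x≡y a r
    ... | refl = subst (λ τ → out ⁅ a ⁆ s τ _) (sym (↾-⁅⁆ σa r)) o

  Individually-∪J : Disjoint C D → (σC : JA AC C) (σD : JA AC D) →
    Individually (C ∪ D) (_∪J_ {C = C} {D = D} σC σD) ≐ (Individually C σC ∩ₚ Individually D σD)
  Individually-∪J {C} {D} disj σC σD = to , from
    where
    τ = _∪J_ {C = C} {D = D} σC σD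
    to : Individually (C ∪ D) τ ⊆ₚ (Individually C σC ∩ₚ Individually D σD)
    to ind = Individually-antitone (p⊆p∪q D) τ σC (λ p → sym (get-∪Jˡ disj σC σD p _)) ind
           , Individually-antitone (q⊆p∪q C D) τ σD (λ p → sym (get-∪Jʳ disj σC σD p _)) ind
    from : (Individually C σC ∩ₚ Individually D σD) ⊆ₚ Individually (C ∪ D) τ
    from (indC , indD) q with x∈p∪q⁻ C D q
    ... | inj₁ p = out-↾-cong σC p τ q (sym (get-∪Jˡ disj σC σD p q)) (indC p)
    ... | inj₂ p = out-↾-cong σD p τ q (sym (get-∪Jʳ disj σC σD p q)) (indD p)

  out⁅a⁆⊆out∅ : Cond-a M s → (σa : JA AC ⁅ a ⁆) → out ⁅ a ⁆ s σa ⊆ₚ out ∅ s ∅J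
  out⁅a⁆⊆out∅ ca σa o = proj₁ (ca _) (σa , o)

  decomposes-empty : Empty C → (σ : JA AC C) → DecomposesAt C σ
  decomposes-empty C-empty σ =
    subst-JA DecomposesAt (sym (Empty-unique C-empty)) {∅J} {σ} (λ p _ → contradiction p ∉⊥)
      ((λ o → o , λ p → contradiction p ∉⊥) , proj₁)

  decomposes-⁅⁆ : Cond-a M s → (σa : JA AC ⁅ a ⁆) → DecomposesAt ⁅ a ⁆ σa
  decomposes-⁅⁆ ca σa =
      (λ o → out⁅a⁆⊆out∅ ca σa o , proj₂ (Individually-⁅⁆ σa) o)
    , (λ (_ , ind) → proj₁ (Individually-⁅⁆ σa) ind)

  decomposes-∪J : Cond2 M s → (disj : Disjoint C D) (σC : JA AC C) (σD : JA AC D) →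
    DecomposesAt C σC → DecomposesAt D σD → DecomposesAt (C ∪ D) (_∪J_ {C = C} {D = D} σC σD)
  decomposes-∪J {C} {D} (_ , c2) disj σC σD decC decD =
      (λ o → let (oC , oD) = proj₁ (c2 C D disj σC σD) o
                 (o∅ , indC) = proj₁ decC oC
             in o∅ , proj₂ (Individually-∪J disj σC σD) (indC , proj₂ (proj₁ decD oD)))
    , (λ (o∅ , ind) → let (indC , indD) = proj₁ (Individually-∪J disj σC σD) ind
                      in proj₂ (c2 C D disj σC σD) (proj₂ decC (o∅ , indC) , proj₂ decD (o∅ , indD)))

  cond1⇒decomposes : Cond1 M s → Decomposes
  cond1⇒decomposes (ca , c1) C σ with nonempty? C
  ... | no C-empty  = decomposes-empty C-empty σ
  ... | yes (a , p) = to , from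
    where
    to : out C s σ ⊆ₚ (out ∅ s ∅J ∩ₚ Individually C σ)
    to o = out⁅a⁆⊆out∅ ca (σ ↾ p) (ind p) , ind
      where
      ind : Individually C σ _
      ind q = proj₁ (c1 C (a , p) σ) o (_ , q)
    from : (out ∅ s ∅J ∩ₚ Individually C σ) ⊆ₚ out C s σ
    from (_ , ind) = proj₂ (c1 C (a , p) σ) (λ (_ , q) → ind q)

  decomposes⇒cond1 : Cond-a M s → Decomposes → Cond1 M s
  decomposes⇒cond1 ca dec = ca , λ C (a , p) σ →
      (λ o (_ , q) → proj₂ (proj₁ (dec C σ) o) q)
    , (λ ind → proj₂ (dec C σ) (out⁅a⁆⊆out∅ ca (σ ↾ p) (ind (a , p)) , λ q → ind (_ , q)))

  decomposes⇒cond2 : Cond-a M s → Decomposes → Cond2 M s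
  decomposes⇒cond2 ca dec = ca , λ C D disj σC σD →
    let τ = _∪J_ {C = C} {D = D} σC σD in
      (λ o → let (o∅ , ind) = proj₁ (dec (C ∪ D) τ) o
                 (indC , indD) = proj₁ (Individually-∪J disj σC σD) ind
             in proj₂ (dec C σC) (o∅ , indC) , proj₂ (dec D σD) (o∅ , indD))
    , (λ (oC , oD) → let (o∅ , indC) = proj₁ (dec C σC) oC
                         indD = proj₂ (proj₁ (dec D σD) oD)
                     in proj₂ (dec (C ∪ D) τ) (o∅ , proj₂ (Individually-∪J disj σC σD) (indC , indD)))

  -- Removing an agent from C is not a structural step, so we recurse on a list of agents covering C.
  decomposes-covered : Cond2 M s → (as : List (Fin n)) (C : Subset n) → (∀ {a} → a ∈ C → a ∈ₗ as) →
    (σ : JA AC C) → DecomposesAt C σ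
  decomposes-covered _ [] C covered = decomposes-empty (λ (_ , p) → ¬Any[] (covered p))
  decomposes-covered c2 (a ∷ as) C covered σ with a ∈? C
  ... | no a∉C = decomposes-covered c2 as C covered′ σ
    where
    covered′ : ∀ {b} → b ∈ C → b ∈ₗ as
    covered′ p with covered p
    ... | here refl  = contradiction p a∉C
    ... | there b∈as = b∈as
  ... | yes a∈C =
    subst-JA DecomposesAt (⁅a⁆∪[C∩∁⁅a⁆]≡C a∈C) (get-∪J-restrict disj (single⊆ a∈C) C′⊆C σ)
      (decomposes-∪J c2 disj (σ ↾ a∈C) σ′ (decomposes-⁅⁆ (proj₁ c2) (σ ↾ a∈C))
        (decomposes-covered c2 as C′ covered′ σ′))
    where
    C′ = C ∩ ∁ ⁅ a ⁆
    C′⊆C : C′ ⊆ C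
    C′⊆C p = proj₁ (x∈p∩q⁻ C (∁ ⁅ a ⁆) p)
    σ′ : JA AC C′
    σ′ = restrict C′⊆C σ
    disj = ⁅a⁆-disjoint-C∩∁⁅a⁆ C a
    covered′ : ∀ {b} → b ∈ C′ → b ∈ₗ as
    covered′ p with covered (C′⊆C p)
    ... | here refl  = contradiction (x∈⁅x⁆ a) (x∈∁p⇒x∉p (proj₂ (x∈p∩q⁻ C (∁ ⁅ a ⁆) p)))
    ... | there b∈as = b∈as

  cond2⇒decomposes : Cond2 M s → Decomposes
  cond2⇒decomposes c2 C = decomposes-covered c2 (allFin n) C (λ {a} _ → ∈-allFin a)

  decomposes⇒cond3 : Cond-a M s → Decomposes → Cond3 M s
  decomposes⇒cond3 ca dec = (λ C σC → to σC , from σC) , fusion-closed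
    where
    to : (σC : JA AC C) → out C s σC ⊆ₚ ExtensionOutcomes C σC
    to {C} σC {x} o = (σAG , override-extends {C = C} σC τ) , proj₂ (dec AG σAG) (o∅ , indAG)
      where
      o∅ = proj₁ (proj₁ (dec C σC) o)
      witness : (a : Fin n) → Σ[ σa ∈ JA AC ⁅ a ⁆ ] out ⁅ a ⁆ s σa x
      witness a = proj₂ (ca a) o∅
      τ : JA AC AG
      τ = build AG (λ a _ → get (proj₁ (witness a)) (x∈⁅x⁆ a))
      σAG = override C σC τ
      indAG : Individually AG σAG x
      indAG {a} q with a ∈? C
      ... | yes p  = out-↾-cong σC p σAG q (sym (get-override-∈ σC τ p q)) (proj₂ (proj₁ (dec C σC) o) p)
      ... | no a∉C = out-↾-cong σa (x∈⁅x⁆ a) σAG q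
                       (sym (trans (get-override-∉ σC τ a∉C q) (get-build AG _ q)))
                       (proj₂ (Individually-⁅⁆ σa) (proj₂ (witness a)) (x∈⁅x⁆ a))
        where σa = proj₁ (witness a)
    from : (σC : JA AC C) → ExtensionOutcomes C σC ⊆ₚ out C s σC
    from {C} σC ((σAG , e) , o) =
      let (o∅ , ind) = proj₁ (dec AG σAG) o
      in proj₂ (dec C σC) (o∅ , Individually-antitone ⊆⊤ σAG σC (λ p → extends⁻ ⊆⊤ σAG e p _) ind)
    fusion-closed : (C : Subset n) (σ σ′ σ″ : JA AC C) → IsFusion σ″ σ σ′ →
      (out C s σ ∩ₚ out C s σ′) ⊆ₚ out C s σ″
    fusion-closed C σ σ′ σ″ fusion (o , o′) = proj₂ (dec C σ″) (proj₁ (proj₁ (dec C σ) o) , ind″)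
      where
      ind″ : Individually C σ″ _
      ind″ {a} p with fusion a p
      ... | inj₁ eq = subst (λ σa → out ⁅ a ⁆ s σa _) (sym eq) (proj₂ (proj₁ (dec C σ) o) p)
      ... | inj₂ eq = subst (λ σa → out ⁅ a ⁆ s σa _) (sym eq) (proj₂ (proj₁ (dec C σ′) o′) p)

  cond3⇒cond-a : Cond3 M s → Cond-a M s
  cond3⇒cond-a (c3a , _) a = to , from
    where
    to : ⋃ (JA AC ⁅ a ⁆) (λ σa → out ⁅ a ⁆ s σa) ⊆ₚ out ∅ s ∅J
    to (σa , o) = let ((σAG , _) , oAG) = proj₁ (c3a ⁅ a ⁆ σa) o
                  in proj₂ (c3a ∅ ∅J) ((σAG , extends⁺ ⊆⊤ (λ p → contradiction p ∉⊥)) , oAG)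
    from : out ∅ s ∅J ⊆ₚ ⋃ (JA AC ⁅ a ⁆) (λ σa → out ⁅ a ⁆ s σa)
    from o = let ((σAG , _) , oAG) = proj₁ (c3a ∅ ∅J) o
                 σa = restrict {C = AG} {D = ⁅ a ⁆} ⊆⊤ σAG
             in σa , proj₂ (c3a ⁅ a ⁆ σa) ((σAG , refl) , oAG)

  cond3⇒cond2 : Cond3 M s → Cond2 M s
  cond3⇒cond2 c3@(c3a , c3b) = cond3⇒cond-a c3 , λ C D disj σC σD → to disj σC σD , from disj σC σD
    where
    to : (disj : Disjoint C D) (σC : JA AC C) (σD : JA AC D) →
      out (C ∪ D) s (_∪J_ {C = C} {D = D} σC σD) ⊆ₚ (out C s σC ∩ₚ out D s σD)
    to {C} {D} disj σC σD o =
      let ((σAG , e) , oAG) = proj₁ (c3a (C ∪ D) _) o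
      in proj₂ (c3a C σC) ((σAG , extends-∪Jˡ disj σC σD σAG e) , oAG)
       , proj₂ (c3a D σD) ((σAG , extends-∪Jʳ disj σC σD σAG e) , oAG)
    from : (disj : Disjoint C D) (σC : JA AC C) (σD : JA AC D) →
      (out C s σC ∩ₚ out D s σD) ⊆ₚ out (C ∪ D) s (_∪J_ {C = C} {D = D} σC σD)
    from {C} {D} disj σC σD (oC , oD) =
      let τ = _∪J_ {C = C} {D = D} σC σD
          ((σ , e) , o) = proj₁ (c3a C σC) oC
          ((σ′ , e′) , o′) = proj₁ (c3a D σD) oD
      in proj₂ (c3a (C ∪ D) τ)
           ((override (C ∪ D) τ σ , override-extends {C = C ∪ D} τ σ)
           , c3b AG σ σ′ _ (override-∪J-fusion disj σ σ′ e e′) (o , o′))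

theorem4p5 : ∀ {n : ℕ} .{{_ : NonZero n}} (M : ActionModel n) (s : ActionModel.ST M) →
    (Cond1 M s ⇔ Cond2 M s) × (Cond2 M s ⇔ Cond3 M s)
theorem4p5 M s =
    mk⇔ (λ c1 → decomposes⇒cond2 M s (proj₁ c1) (cond1⇒decomposes M s c1))
        (λ c2 → decomposes⇒cond1 M s (proj₁ c2) (cond2⇒decomposes M s c2))
  , mk⇔ (λ c2 → decomposes⇒cond3 M s (proj₁ c2) (cond2⇒decomposes M s c2))
        (cond3⇒cond2 M s)
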